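{- Let $(\Sigma,\Gamma,\mathcal U)$ be an extended many-sorted finite model finding problem and let $f:A_1\times\dots\times A_k\to B$ be a domain-range distinct function symbol of $\Sigma$. Let $X\subseteq\mathcal U(B)$ be a value-interchangeable set for $B$, enumerated as $b_1,\dots,b_n$ (distinct), and take an arbitrary ordering $t_1,\dots,t_m$ of the tuples in $\mathcal U(A_1)\times\dots\times\mathcal U(A_k)$. Let $I$ be any interpretation of $(\Sigma,\Gamma,\mathcal U)$. Then there exists an interpretation $I'$ isomorphic to $I$ satisfying $\left(\bigvee_{j=1}^{i} f(t_i)=b_j\right)\lor\left(\bigvee_{b\in\mathcal U(B)\setminus X} f(t_i)=b\right)$ for each $i=1,\dots,\min\{m,n\}$, i.e. $I'(f)(t_i)\in\{b_1,\dots,b_i\}\cup(\mathcal U(B)\setminus X)$.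
   Context: A function symbol $f:A_1\times\dots\times A_k\to B$ is domain-range distinct (DRD) if $B$ is distinct from each of $A_1,\dots,A_k$ (the $A_i$ need not be mutually distinct). A signature $\Sigma$ consists of a finite set of sorts, a finite set of function symbols $g:A_1\times\dots\times A_n\to B$ (constants when $n=0$), and a finite set of predicate symbols $R:A_1\times\dots\times A_n\to\mathrm{Bool}$. A domain assignment $\mathcal U$ maps each sort to a nonempty finite set. An extended MSFMF problem is $(\Sigma,\Gamma,\mathcal U)$ where $\Gamma$ is a finite set of many-sorted first-order formulas (with equality) over $\Sigma$ in which every domain value $v\in\mathcal U(\theta)$ may also be used as a term of sort $\theta$ (evaluating to itself). An interpretation $I$ assigns each function symbol $g:A_1\times\dots\times A_n\to B$ a function $\mathcal U(A_1)\times\dots\times\mathcal U(A_n)\to\mathcal U(B)$ and each predicate symbol a relation on the corresponding product of domains. A domain permutation $\sigma$ is a family of permutations $\sigma_\theta$ of $\mathcal U(\theta)$, one per sort; it acts by $(\sigma\bullet I)(g)(\sigma_{A_1}(a_1),\dots,\sigma_{A_n}(a_n))=\sigma_B(I(g)(a_1,\dots,a_n))$ and $(a_1,\dots,a_n)\in I(R)\iff(\sigma_{A_1}(a_1),\dots,\sigma_{A_n}(a_n))\in(\sigma\bullet I)(R)$. A domain symmetry is a domain permutation $\sigma$ such that for every interpretation $I$, $\sigma\bullet I\models\Gamma$ iff $I\models\Gamma$. Interpretations $I,I'$ are isomorphic if $I'=\sigma\bullet I$ for some domain symmetry $\sigma$. A set $X\subseteq\mathcal U(\theta)$ is value-interchangeable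 for $\theta$ if every domain permutation $\sigma$ with $\sigma_\theta(v)=v$ for all $v\in\mathcal U(\theta)\setminus X$ and $\sigma_{\theta'}$ the identity for all sorts $\theta'\neq\theta$ is a domain symmetry. -}

module Defs where

open import Data.Nat using (ℕ; zero; suc; _≤_; _<_)
open import Data.Fin using (Fin; toℕ)
open import Data.Fin.Properties using (_≟_)
open import Data.Fin.Subset using (Subset; _∈_; _∉_)
open import Data.Fin.Permutation using (Permutation′; _⟨$⟩ʳ_; _⟨$⟩ˡ_)
open import Data.Bool using (Bool; true; false; _∧_; _∨_; not)
open import Data.List using (List; []; _∷_)
open import Data.List.Relation.Unary.All using (All; []; _∷_)
open import Data.List.Membership.Propositional using () renaming (_∈_ to _∈ₗ_)
open import Data.List.Relation.Unary.Any using (here; there)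
open import Data.Product using (Σ; ∃; ∃-syntax; _×_; _,_)
open import Data.Sum using (_⊎_)
open import Relation.Nullary using (¬_; does)
open import Relation.Binary.PropositionalEquality using (_≡_; _≢_)
open import Function.Definitions using (Injective; Surjective)

record Signature : Set where
  field
    nSorts : ℕ
    nFuns  : ℕ
    funDom : Fin nFuns → List (Fin nSorts)
    funCod : Fin nFuns → Fin nSorts
    nPreds : ℕ
    predDom : Fin nPreds → List (Fin nSorts)

Sort : Signature → Set
Sort Σ' = Fin (Signature.nSorts Σ')

record DomainAssignment (Σ' : Signature) : Set where
  field
    size     : Sort Σ' → ℕ
    nonempty : ∀ θ → 1 ≤ size θ

-- Syntax and semantics of many-sorted FOL with equality, where domain
-- values may be used as terms (extended MSFMF problems).

module Logic (Σ' : Signature) (𝒰 : DomainAssignment Σ') where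
  open Signature Σ'
  open DomainAssignment 𝒰

  Dom : Fin nSorts → Set
  Dom θ = Fin (size θ)

  Tuple : List (Fin nSorts) → Set
  Tuple As = All Dom As

  Ctx : Set
  Ctx = List (Fin nSorts)

  mutual
    data Term (Δ : Ctx) : Fin nSorts → Set where
      var : ∀ {θ} → θ ∈ₗ Δ → Term Δ θ
      val : ∀ {θ} → Dom θ → Term Δ θ
      app : (g : Fin nFuns) → Terms Δ (funDom g) → Term Δ (funCod g)

    data Terms (Δ : Ctx) : List (Fin nSorts) → Set where
      []  : Terms Δ []
      _∷_ : ∀ {θ θs} → Term Δ θ → Terms Δ θs → Terms Δ (θ ∷ θs)

  data Formula (Δ : Ctx) : Set where
    ⊤′ ⊥′   : Formula Δ
    eq      : ∀ {θ} → Term Δ θ → Term Δ θ → Formula Δ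
    pred    : (r : Fin nPreds) → Terms Δ (predDom r) → Formula Δ
    ¬′_     : Formula Δ → Formula Δ
    _∧′_ _∨′_ _⇒′_ _⇔′_ : Formula Δ → Formula Δ → Formula Δ
    all′ ex′ : (θ : Fin nSorts) → Formula (θ ∷ Δ) → Formula Δ

  Sentence : Set
  Sentence = Formula []

  record Interpretation : Set where
    field
      fun : (g : Fin nFuns) → Tuple (funDom g) → Dom (funCod g)
      rel : (r : Fin nPreds) → Tuple (predDom r) → Bool

  open Interpretation public

  Env : Ctx → Set
  Env Δ = All Dom Δ

  lookupEnv : ∀ {Δ θ} → Env Δ → θ ∈ₗ Δ → Dom θ
  lookupEnv (x ∷ _) (here _≡_.refl) = x
  lookupEnv (_ ∷ ρ) (there p) = lookupEnv ρ p

  mutual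
    evalT : ∀ {Δ θ} → Interpretation → Env Δ → Term Δ θ → Dom θ
    evalT I ρ (var p) = lookupEnv ρ p
    evalT I ρ (val v) = v
    evalT I ρ (app g ts) = fun I g (evalTs I ρ ts)

    evalTs : ∀ {Δ θs} → Interpretation → Env Δ → Terms Δ θs → Tuple θs
    evalTs I ρ [] = []
    evalTs I ρ (t ∷ ts) = evalT I ρ t ∷ evalTs I ρ ts

  allFin : (n : ℕ) → (Fin n → Bool) → Bool
  allFin zero    p = true
  allFin (suc n) p = p Fin.zero ∧ allFin n (λ i → p (Fin.suc i))

  anyFin : (n : ℕ) → (Fin n → Bool) → Bool
  anyFin zero    p = false
  anyFin (suc n) p = p Fin.zero ∨ anyFin n (λ i → p (Fin.suc i))

  _⇔ᵇ_ : Bool → Bool → Bool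
  true  ⇔ᵇ b = b
  false ⇔ᵇ b = not b

  eval : ∀ {Δ} → Interpretation → Env Δ → Formula Δ → Bool
  eval I ρ ⊤′ = true
  eval I ρ ⊥′ = false
  eval I ρ (eq s t) = does (evalT I ρ s ≟ evalT I ρ t)
  eval I ρ (pred r ts) = rel I r (evalTs I ρ ts)
  eval I ρ (¬′ φ) = not (eval I ρ φ)
  eval I ρ (φ ∧′ ψ) = eval I ρ φ ∧ eval I ρ ψ
  eval I ρ (φ ∨′ ψ) = eval I ρ φ ∨ eval I ρ ψ
  eval I ρ (φ ⇒′ ψ) = not (eval I ρ φ) ∨ eval I ρ ψ
  eval I ρ (φ ⇔′ ψ) = eval I ρ φ ⇔ᵇ eval I ρ ψ
  eval I ρ (all′ θ φ) = allFin (size θ) (λ a → eval I (a ∷ ρ) φ)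
  eval I ρ (ex′ θ φ) = anyFin (size θ) (λ a → eval I (a ∷ ρ) φ)

  _⊨_ : Interpretation → List Sentence → Bool
  I ⊨ [] = true
  I ⊨ (φ ∷ Γ) = eval I [] φ ∧ (I ⊨ Γ)

  DomainPermutation : Set
  DomainPermutation = (θ : Fin nSorts) → Permutation′ (size θ)

  mapInv : DomainPermutation → ∀ {As} → Tuple As → Tuple As
  mapInv σ [] = []
  mapInv σ {A ∷ _} (a ∷ as) = (σ A ⟨$⟩ˡ a) ∷ mapInv σ as

  -- (σ•I)(g)(σ(a⃗)) = σ_B(I(g)(a⃗)),  a⃗ ∈ I(R) ⇔ σ(a⃗) ∈ (σ•I)(R)
  _•_ : DomainPermutation → Interpretation → Interpretation
  fun (σ • I) g t = σ (funCod g) ⟨$⟩ʳ fun I g (mapInv σ t)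
  rel (σ • I) r t = rel I r (mapInv σ t)

  _≈I_ : Interpretation → Interpretation → Set
  I ≈I J = (∀ g t → fun I g t ≡ fun J g t) × (∀ r t → rel I r t ≡ rel J r t)

  DomainSymmetry : List Sentence → DomainPermutation → Set
  DomainSymmetry Γ σ = ∀ I → (σ • I) ⊨ Γ ≡ I ⊨ Γ

  Isomorphic : List Sentence → Interpretation → Interpretation → Set
  Isomorphic Γ I I′ = ∃[ σ ] (DomainSymmetry Γ σ × (I′ ≈I (σ • I)))

  ValueInterchangeable : List Sentence → (θ : Fin nSorts) → Subset (size θ) → Set
  ValueInterchangeable Γ θ X =
    ∀ (σ : DomainPermutation) →
      (∀ v → v ∉ X → σ θ ⟨$⟩ʳ v ≡ v) →
      (∀ θ′ → θ′ ≢ θ → ∀ a → σ θ′ ⟨$⟩ʳ a ≡ a) →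
      DomainSymmetry Γ σ

  DRD : Fin nFuns → Set
  DRD f = All (λ A → A ≢ funCod f) (funDom f)

module Submission where

-- Because X is value-interchangeable, every permutation π of U(B) fixing the values
-- outside X, extended by the identity on the other sorts, is a domain symmetry; since f is
-- domain-range distinct, it acts on f by post-composition: I′(f)(u) = π(I(f)(u)). So it
-- suffices to find such a π with π(I(f)(tᵢ)) ∈ {b₀,…,bᵢ} ∪ (U(B) ∖ X) for all i < min(m,n).
-- It is built index by index: if the value at tᵢ is currently some bⱼ with j > i, compose
-- with the transposition of bⱼ and bᵢ, which fixes b₀,…,bᵢ₋₁ and everything outside X.

open import Data.Nat using (ℕ; zero; suc; _≤_; _<_; _≤?_; _<?_)
open import Data.Nat.Properties using (m<1+n⇒m<n∨m≡n; ≰⇒>; <-≤-trans; ≤-<-trans; <⇒≤; ≤-refl; ≤-reflexive)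
open import Data.Fin using (Fin; toℕ; fromℕ<)
open import Data.Fin.Properties using (_≟_; toℕ-injective; toℕ-fromℕ<; toℕ<n; <⇒≢)
open import Data.Fin.Subset using (Subset; _∈_; _∉_)
open import Data.Fin.Subset.Properties using (_∈?_)
open import Data.Fin.Permutation using (Permutation′; _⟨$⟩ʳ_; _⟨$⟩ˡ_; transpose; _∘ₚ_; id)
open import Data.List using (List; []; _∷_)
open import Data.List.Relation.Unary.All using (All; []; _∷_)
open import Data.Product using (∃; ∃-syntax; _×_; _,_; proj₁; proj₂)
open import Data.Sum using (_⊎_; inj₁; inj₂)
open import Relation.Nullary using (yes; no; contradiction)
open import Relation.Nullary.Decidable using (dec-true; dec-false)
open import Relation.Binary.PropositionalEquality
open import Function.Definitions using (Injective)

open import Defs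

transpose-matchˡ : ∀ {N} (v w : Fin N) → transpose v w ⟨$⟩ʳ v ≡ w
transpose-matchˡ v w rewrite dec-true (v ≟ v) refl = refl

transpose-fixes : ∀ {N} {v w u : Fin N} → u ≢ v → u ≢ w → transpose v w ⟨$⟩ʳ u ≡ u
transpose-fixes {v = v} {w} {u} u≢v u≢w
  rewrite dec-false (u ≟ v) u≢v | dec-false (u ≟ w) u≢w = refl

module _ {N : ℕ} (X : Subset N) where

  FixesOutside : Permutation′ N → Set
  FixesOutside π = ∀ v → v ∉ X → π ⟨$⟩ʳ v ≡ v

  fixesOutside-∘ₚ : ∀ {π ρ} → FixesOutside π → FixesOutside ρ → FixesOutside (π ∘ₚ ρ)
  fixesOutside-∘ₚ {π} {ρ} π-fixes ρ-fixes v v∉X =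
    trans (cong (ρ ⟨$⟩ʳ_) (π-fixes v v∉X)) (ρ-fixes v v∉X)

  transpose-fixesOutside : ∀ {v w} → v ∈ X → w ∈ X → FixesOutside (transpose v w)
  transpose-fixesOutside v∈X w∈X u u∉X =
    transpose-fixes (λ { refl → u∉X v∈X }) (λ { refl → u∉X w∈X })

module Canonicalisation
  {N n : ℕ} (X : Subset N) (b : Fin n → Fin N) (b-injective : Injective _≡_ _≡_ b)
  (b-enumerates : ∀ v → (v ∈ X → ∃[ j ] b j ≡ v) × (∃[ j ] b j ≡ v → v ∈ X))
  {m : ℕ} (g : Fin m → Fin N)
  where

  b∈X : ∀ j → b j ∈ X
  b∈X j = proj₂ (b-enumerates (b j)) (j , refl)

  Canonical : Permutation′ N → Fin m → Set
  Canonical π i = (∃[ j ] (toℕ j ≤ toℕ i × π ⟨$⟩ʳ g i ≡ b j)) ⊎ (π ⟨$⟩ʳ g i ∉ X)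

  CanonicalBelow : Permutation′ N → ℕ → Set
  CanonicalBelow π k = ∀ i → toℕ i < k → toℕ i < n → Canonical π i

  canonical-∘ₚ : ∀ {π τ i} → FixesOutside X τ → (∀ j → toℕ j ≤ toℕ i → τ ⟨$⟩ʳ b j ≡ b j) →
                 Canonical π i → Canonical (π ∘ₚ τ) i
  canonical-∘ₚ {τ = τ} τ-fixes τ-fixes-b (inj₁ (j , j≤i , πgi≡bj)) =
    inj₁ (j , j≤i , trans (cong (τ ⟨$⟩ʳ_) πgi≡bj) (τ-fixes-b j j≤i))
  canonical-∘ₚ {π} {τ} τ-fixes _ (inj₂ πgi∉X) =
    inj₂ (subst (_∉ X) (sym (τ-fixes (π ⟨$⟩ʳ g _) πgi∉X)) πgi∉X)

  canonicalBelow-suc : ∀ {π i} → CanonicalBelow π (toℕ i) → (toℕ i < n → Canonical π i) →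
                       CanonicalBelow π (suc (toℕ i))
  canonicalBelow-suc {π} below new i′ i′≤i i′<n with m<1+n⇒m<n∨m≡n i′≤i
  ... | inj₁ i′<i = below i′ i′<i i′<n
  ... | inj₂ i′≡i = subst (Canonical π) (sym (toℕ-injective i′≡i)) (new (subst (_< n) i′≡i i′<n))

  canonicalise-at : ∀ {π} (i : Fin m) → toℕ i < n → FixesOutside X π → CanonicalBelow π (toℕ i) →
                    ∃[ π′ ] FixesOutside X π′ × CanonicalBelow π′ (suc (toℕ i))
  canonicalise-at {π} i i<n π-fixes below with π ⟨$⟩ʳ g i ∈? X
  ... | no πgi∉X = π , π-fixes , canonicalBelow-suc {π} below (λ _ → inj₂ πgi∉X)
  ... | yes πgi∈X with proj₁ (b-enumerates (π ⟨$⟩ʳ g i)) πgi∈X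
  ...   | j , bj≡πgi with toℕ j ≤? toℕ i
  ...     | yes j≤i = π , π-fixes , canonicalBelow-suc {π} below (λ _ → inj₁ (j , j≤i , sym bj≡πgi))
  ...     | no j≰i = π ∘ₚ τ , fixesOutside-∘ₚ X {π} {τ} π-fixes τ-fixes ,
                     canonicalBelow-suc {π ∘ₚ τ} earlier (λ _ → inj₁ (k , ≤-reflexive k≡i , τ-sends-πgi))
    where
    k : Fin n
    k = fromℕ< i<n
    k≡i : toℕ k ≡ toℕ i
    k≡i = toℕ-fromℕ< i<n
    τ : Permutation′ N
    τ = transpose (b j) (b k)
    τ-fixes : FixesOutside X τ
    τ-fixes = transpose-fixesOutside X (b∈X j) (b∈X k)
    τ-fixes-below : ∀ {i′ : Fin m} → toℕ i′ < toℕ i →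
                    ∀ j′ → toℕ j′ ≤ toℕ i′ → τ ⟨$⟩ʳ b j′ ≡ b j′
    τ-fixes-below i′<i j′ j′≤i′ = transpose-fixes
      (λ bj′≡bj → <⇒≢ (<-≤-trans j′<i (<⇒≤ (≰⇒> j≰i))) (b-injective bj′≡bj))
      (λ bj′≡bk → <⇒≢ (subst (_ <_) (sym k≡i) j′<i) (b-injective bj′≡bk))
      where j′<i = ≤-<-trans j′≤i′ i′<i
    earlier : CanonicalBelow (π ∘ₚ τ) (toℕ i)
    earlier i′ i′<i i′<n =
      canonical-∘ₚ {π} {τ} τ-fixes (τ-fixes-below {i′} i′<i) (below i′ i′<i i′<n)
    τ-sends-πgi : τ ⟨$⟩ʳ (π ⟨$⟩ʳ g i) ≡ b k
    τ-sends-πgi = trans (cong (τ ⟨$⟩ʳ_) (sym bj≡πgi)) (transpose-matchˡ (b j) (b k))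

  HasCanonicalBelow : ℕ → Set
  HasCanonicalBelow k = ∃[ π ] FixesOutside X π × CanonicalBelow π k

  hasCanonicalBelow-suc : ∀ {k} (i : Fin m) → toℕ i ≡ k → HasCanonicalBelow k → HasCanonicalBelow (suc k)
  hasCanonicalBelow-suc i refl (π , π-fixes , below) with toℕ i <? n
  ... | yes i<n = canonicalise-at {π} i i<n π-fixes below
  ... | no i≮n = π , π-fixes , canonicalBelow-suc {π} below (λ i<n → contradiction i<n i≮n)

  hasCanonicalBelow : ∀ k → k ≤ m → HasCanonicalBelow k
  hasCanonicalBelow zero _ = id , (λ _ _ → refl) , (λ _ ())
  hasCanonicalBelow (suc k) k<m =
    hasCanonicalBelow-suc (fromℕ< k<m) (toℕ-fromℕ< k<m) (hasCanonicalBelow k (<⇒≤ k<m))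

  canonicalPermutation : ∃[ π ] FixesOutside X π × (∀ i → toℕ i < n → Canonical π i)
  canonicalPermutation with hasCanonicalBelow m ≤-refl
  ... | π , π-fixes , below = π , π-fixes , λ i → below i (toℕ<n i)

module _ (Σ' : Signature) (𝒰 : DomainAssignment Σ') where
  open Signature Σ'
  open DomainAssignment 𝒰
  open Logic Σ' 𝒰

  onSort : (B : Sort Σ') → Permutation′ (size B) → DomainPermutation
  onSort B π θ with θ ≟ B
  ... | yes refl = π
  ... | no _ = id

  onSort-≡ : ∀ B π → onSort B π B ≡ π
  onSort-≡ B π with B ≟ B
  ... | yes refl = refl
  ... | no B≢B = contradiction refl B≢B

  onSort-≢ : ∀ {B θ} π → θ ≢ B → onSort B π θ ≡ id
  onSort-≢ {B} {θ} π θ≢B with θ ≟ B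
  ... | yes θ≡B = contradiction θ≡B θ≢B
  ... | no _ = refl

  mapInv-onSort : ∀ {B As} π → All (_≢ B) As → (u : Tuple As) → mapInv (onSort B π) u ≡ u
  mapInv-onSort π [] [] = refl
  mapInv-onSort π (A≢B ∷ As≢B) (a ∷ u) =
    cong₂ _∷_ (cong (_⟨$⟩ˡ a) (onSort-≢ π A≢B)) (mapInv-onSort π As≢B u)

  fun-onSort-• : ∀ {f} → DRD f → ∀ π I u → fun (onSort (funCod f) π • I) f u ≡ π ⟨$⟩ʳ fun I f u
  fun-onSort-• {f} drd π I u = begin
    onSort (funCod f) π (funCod f) ⟨$⟩ʳ fun I f (mapInv (onSort (funCod f) π) u)
      ≡⟨ cong (λ ρ → ρ ⟨$⟩ʳ fun I f (mapInv (onSort (funCod f) π) u)) (onSort-≡ (funCod f) π) ⟩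
    π ⟨$⟩ʳ fun I f (mapInv (onSort (funCod f) π) u)
      ≡⟨ cong (λ u′ → π ⟨$⟩ʳ fun I f u′) (mapInv-onSort π drd u) ⟩
    π ⟨$⟩ʳ fun I f u ∎
    where open ≡-Reasoning

  onSort-domainSymmetry : ∀ {Γ B X} → ValueInterchangeable Γ B X →
                          ∀ π → FixesOutside X π → DomainSymmetry Γ (onSort B π)
  onSort-domainSymmetry {B = B} interchangeable π π-fixes =
    interchangeable (onSort B π)
      (λ v v∉X → trans (cong (_⟨$⟩ʳ v) (onSort-≡ B π)) (π-fixes v v∉X))
      (λ θ θ≢B a → cong (_⟨$⟩ʳ a) (onSort-≢ π θ≢B))

mainTheorem10 :
  (Σ' : Signature) (𝒰 : DomainAssignment Σ') (Γ : List (Logic.Sentence Σ' 𝒰)) →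
  let open Signature Σ'
      open DomainAssignment 𝒰
      open Logic Σ' 𝒰
  in (f : Fin nFuns) → DRD f →
     (X : Subset (size (funCod f))) → ValueInterchangeable Γ (funCod f) X →
     (n : ℕ) (b : Fin n → Dom (funCod f)) → Injective _≡_ _≡_ b →
     (∀ v → (v ∈ X → ∃[ j ] b j ≡ v) × (∃[ j ] b j ≡ v → v ∈ X)) →
     (m : ℕ) (t : Fin m → Tuple (funDom f)) → Injective _≡_ _≡_ t →
     (∀ u → ∃[ i ] t i ≡ u) →
     (I : Interpretation) →
     ∃[ I′ ] (Isomorphic Γ I I′ ×
       (∀ (i : Fin m) → toℕ i < n →
         (∃[ j ] (toℕ j ≤ toℕ i × fun I′ f (t i) ≡ b j))
         ⊎ (fun I′ f (t i) ∉ X)))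
-- Any family of tuples works: the ordering t need be neither injective nor surjective.
mainTheorem10 Σ' 𝒰 Γ f drd X interchangeable n b b-injective b-enumerates m t _ _ I
  with Canonicalisation.canonicalPermutation X b b-injective b-enumerates (λ i → Logic.fun I f (t i))
... | π , π-fixes , π-canonical =
  σ • I ,
  (σ , onSort-domainSymmetry Σ' 𝒰 {Γ} interchangeable π π-fixes , (λ _ _ → refl) , (λ _ _ → refl)) ,
  canonical
  where
  open Signature Σ'
  open Logic Σ' 𝒰
  σ : DomainPermutation
  σ = onSort Σ' 𝒰 (funCod f) π
  canonical : ∀ i → toℕ i < n →
              (∃[ j ] (toℕ j ≤ toℕ i × fun (σ • I) f (t i) ≡ b j)) ⊎ (fun (σ • I) f (t i) ∉ X)
  canonical i rewrite fun-onSort-• Σ' 𝒰 drd π I (t i) = π-canonical i
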